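{- Let $T[1,n]$ be a string with $T[n]=\$$ as in the context, with inverse suffix array $ISA$ and Lyndon array $\lambda$. Let $\lambda_{BP}$ be the parenthesis string produced by the following procedure: start with the empty string and an empty stack of integers; for $i=1,\dots,n$: while the stack is nonempty and its top element is greater than $ISA[i]$, pop the stack and append ")" to $\lambda_{BP}$; then push $ISA[i]$ and append "(" to $\lambda_{BP}$; after the loop, pop the stack and append ")". Then $\lambda_{BP}$ is a balanced parenthesis string with $n$ open and $n$ closed parentheses, and, setting for $i=1,\dots,n$, $o_i=\mathrm{selectopen}(\lambda_{BP},i)$ and $c_i=\mathrm{selectclose}(\lambda_{BP},i)$, we have $\lambda[i]=(c_i-o_i+1)/2$.
   Context: $T[1,n]$ is a string over an ordered alphabet whose last symbol $T[n]=\$$ occurs nowhere else and is smaller than every other symbol. $SA$ is the suffix array of $T$ (the permutation with $T[SA[1],n]\prec\cdots\prec T[SA[n],n]$, $\prec$ strict lexicographic order) and $ISA$ its inverse, so $ISA[i]$ is the lexicographic rank of suffix $T[i,n]$. A Lyndon word is a nonempty string strictly lexicographically smaller than all of its proper rotations; $\lambda[i]$ is the length of the longest Lyndon word starting at position $i$ of $T$. For a balanced parenthesis string $S$, $\mathrm{selectopen}(S,i)$ is the position in $S$ of the $i$-th open parenthesis and $\mathrm{selectclose}(S,i)$ is the position in $S$ of the closed parenthesis matching the $i$-th open parenthesis. -}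

module Defs where

open import Level using (0ℓ)
open import Data.Nat using (ℕ; zero; suc; _+_; _∸_; _≤_; _<_; _<ᵇ_)
open import Data.Bool using (Bool; true; false; if_then_else_)
open import Data.List using (List; []; _∷_; _++_; length; drop; take; map; filter; upTo)
open import Data.Maybe using (Maybe; just; nothing)
open import Data.Product using (_×_; _,_; ∃)
open import Relation.Binary.Core using (Rel)
open import Relation.Binary.Structures using (IsStrictTotalOrder)
open import Relation.Binary.PropositionalEquality using (_≡_)
open import Data.List.Relation.Binary.Lex.Strict using (Lex-<; <-decidable)

-- strict lexicographic order on strings (a proper prefix is smaller)
_⊏_ : {A : Set} → Rel A 0ℓ → Rel (List A) 0ℓ
_⊏_ _≺_ = Lex-< _≡_ _≺_

Lyndon : {A : Set} → Rel A 0ℓ → List A → Set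
Lyndon _≺_ w = (0 < length w) ×
  (∀ k → 0 < k → k < length w → (_⊏_ _≺_) w (drop k w ++ take k w))

-- LongestLyndon ≺ T i ℓ : ℓ is the length of the longest Lyndon word
-- starting at (0-based) position i of T, i.e. ℓ = λ[i+1] in the paper.
LongestLyndon : {A : Set} → Rel A 0ℓ → List A → ℕ → ℕ → Set
LongestLyndon _≺_ T i ℓ =
  (ℓ ≤ length T ∸ i) × Lyndon _≺_ (take ℓ (drop i T)) ×
  (∀ m → m ≤ length T ∸ i → Lyndon _≺_ (take m (drop i T)) → m ≤ ℓ)

module _ {A : Set} {_≺_ : Rel A 0ℓ} (sto : IsStrictTotalOrder _≡_ _≺_) where
  open IsStrictTotalOrder sto using (_≟_; _<?_)

  _⊏?_ = <-decidable _≟_ _<?_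

  -- ISA[k+1] in the paper: lexicographic rank (1-based) of suffix T[k+1,n],
  -- i.e. 1 + number of suffixes strictly smaller than it.
  ISA : List A → ℕ → ℕ
  ISA T k = suc (length (filter (λ j → drop j T ⊏? drop k T) (upTo (length T))))

data Paren : Set where
  op cl : Paren

data Balanced : List Paren → Set where
  empty : Balanced []
  wrap  : ∀ {s t} → Balanced s → Balanced t → Balanced (op ∷ s ++ cl ∷ t)

countOpen : List Paren → ℕ
countOpen [] = 0
countOpen (op ∷ s) = suc (countOpen s)
countOpen (cl ∷ s) = countOpen s

countClose : List Paren → ℕ
countClose [] = 0
countClose (op ∷ s) = countClose s
countClose (cl ∷ s) = suc (countClose s)

-- 1-based access S[p]
at : List Paren → ℕ → Maybe Paren
at [] p = nothing
at (x ∷ s) zero = nothing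
at (x ∷ s) (suc zero) = just x
at (x ∷ s) (suc (suc p)) = at s (suc p)

SelectOpen : List Paren → ℕ → ℕ → Set
SelectOpen S i o = (at S o ≡ just op) × (countOpen (take o S) ≡ i)

Matches : List Paren → ℕ → ℕ → Set
Matches S o c = (at S o ≡ just op) × (at S c ≡ just cl) × (o < c) ×
  Balanced (take (c ∸ o ∸ 1) (drop o S))

SelectClose : List Paren → ℕ → ℕ → Set
SelectClose S i c = ∃ λ o → SelectOpen S i o × Matches S o c

popGT : ℕ → List ℕ → List Paren × List ℕ
popGT x [] = [] , []
popGT x (y ∷ st) with x <ᵇ y
... | true  with popGT x st
...   | (ps , st') = cl ∷ ps , st'
popGT x (y ∷ st) | false = [] , y ∷ st

run : List ℕ → List ℕ → List Paren
run [] [] = []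
run (y ∷ st) [] = cl ∷ []
run st (x ∷ xs) with popGT x st
... | (ps , st') = ps ++ op ∷ run (x ∷ st') xs

module _ {A : Set} {_≺_ : Rel A 0ℓ} (sto : IsStrictTotalOrder _≡_ _≺_) where
  λBP : List A → List Paren
  λBP T = run [] (map (ISA sto T) (upTo (length T)))

module Submission where

-- Both sides of λ[i] = (c_i - o_i + 1)/2 are computed from one quantity: the
-- next position j > i whose suffix has smaller rank (j = n if there is none).
--
-- Run on values
--    f 0, …, f m whose last value is the strict minimum, the procedure emits one
--    '(' per value, and the '(' of f i is closed right before the next smaller
--    value f j is read (the last value by the final pop), enclosing a balanced
--    block with one '(' per value strictly between i and j.  Hence the output is
--    balanced and (c - o + 1)/2 = j - i  (matching, run-wellFormed, encloses,
--    select-enclosed, module NextSmaller).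
-- 2. Lyndon words.  If s is smaller than its suffixes at 0 < k < L and its
--    suffix at L is smaller than s, its longest Lyndon prefix has length L
--    (module LexOrder.LyndonPrefix, via: Lyndon words are unbordered).
-- 3. Ranks.  ISA is strictly monotone in the suffix order (module Ranks), so the
--    next position j of smaller rank after i satisfies the hypotheses of 2 for
--    s = T[i..]; the sentinel makes the last rank the minimum required in 1.
-- The theorem applies 1 and 2-3 to each position i.

open import Defs
open import Level using (0ℓ)
open import Function using (_∘_)
open import Data.Nat using (ℕ; zero; suc; _+_; _*_; _∸_; _/_; _≤_; _<_; _<ᵇ_; z≤n; s≤s; z<s; s≤s⁻¹)
open import Data.Nat.Properties
open import Data.Nat.DivMod using (m*n/n≡m)
open import Data.Bool using (true; false) renaming (T to IsTrue)
open import Data.Fin using (Fin; toℕ)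
open import Data.Fin.Properties using (toℕ<n)
open import Data.Maybe using (just)
open import Data.List using (List; []; _∷_; _++_; length; take; drop; map; filter; upTo; applyUpTo)
open import Data.List.Properties
  using (++-assoc; ++-identityʳ; length-++; length-map; length-upTo; length-take; length-drop;
         take++drop≡id; take-take; drop-drop; drop-all; map-++)
open import Data.List.Relation.Unary.All using (All; []; _∷_)
open import Data.List.Relation.Unary.All.Properties using (++⁻ʳ; map⁺)
open import Data.List.Membership.Propositional using (_∈_)
open import Data.List.Membership.Propositional.Properties using (∈-upTo⁺)
open import Data.List.Relation.Unary.Any using (here; there)
open import Data.List.Relation.Binary.Lex.Core using (halt; this; next)
import Data.List.Relation.Binary.Lex.Strict as Lex
open import Data.List.Relation.Binary.Pointwise using (Pointwise-≡⇒≡)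
open import Data.Product using (_×_; _,_; proj₁; proj₂; Σ; ∃₂)
open import Data.Sum using (_⊎_; inj₁; inj₂)
open import Data.Empty using (⊥; ⊥-elim)
open import Relation.Nullary using (¬_; Dec; yes; no)
open import Relation.Unary using (Decidable)
open import Relation.Binary.Core using (Rel)
open import Relation.Binary.Structures using (IsStrictTotalOrder)
open import Relation.Binary.Definitions using (tri<; tri≈; tri>)
open import Relation.Binary.PropositionalEquality

countOpen-++ : ∀ s t → countOpen (s ++ t) ≡ countOpen s + countOpen t
countOpen-++ []       t = refl
countOpen-++ (op ∷ s) t = cong suc (countOpen-++ s t)
countOpen-++ (cl ∷ s) t = countOpen-++ s t

countClose-++ : ∀ s t → countClose (s ++ t) ≡ countClose s + countClose t
countClose-++ []       t = refl
countClose-++ (op ∷ s) t = countClose-++ s t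
countClose-++ (cl ∷ s) t = cong suc (countClose-++ s t)

length≡opens+closes : ∀ s → length s ≡ countOpen s + countClose s
length≡opens+closes []       = refl
length≡opens+closes (op ∷ s) = cong suc (length≡opens+closes s)
length≡opens+closes (cl ∷ s) = trans (cong suc (length≡opens+closes s)) (sym (+-suc _ _))

balanced⇒opens≡closes : ∀ {s} → Balanced s → countOpen s ≡ countClose s
balanced⇒opens≡closes empty = refl
balanced⇒opens≡closes (wrap {s} {t} bs bt) = begin
  suc (countOpen (s ++ cl ∷ t))            ≡⟨ cong suc (countOpen-++ s (cl ∷ t)) ⟩
  suc (countOpen s + countOpen t)
    ≡⟨ cong suc (cong₂ _+_ (balanced⇒opens≡closes bs) (balanced⇒opens≡closes bt)) ⟩
  suc (countClose s + countClose t)        ≡⟨ sym (+-suc (countClose s) (countClose t)) ⟩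
  countClose s + suc (countClose t)        ≡⟨ sym (countClose-++ s (cl ∷ t)) ⟩
  countClose (s ++ cl ∷ t)                 ∎
  where open ≡-Reasoning

at-++ : ∀ P X p → at (P ++ X) (length P + suc p) ≡ at X (suc p)
at-++ []          X p = refl
at-++ (a ∷ [])    X p = refl
at-++ (a ∷ b ∷ P) X p = at-++ (b ∷ P) X p

take-length-++ : ∀ {A : Set} (P X : List A) n → take (length P + n) (P ++ X) ≡ P ++ take n X
take-length-++ []      X n = refl
take-length-++ (a ∷ P) X n = cong (a ∷_) (take-length-++ P X n)

drop-length-++ : ∀ {A : Set} (P X : List A) n → drop (length P + n) (P ++ X) ≡ drop n X
drop-length-++ []      X n = refl
drop-length-++ (a ∷ P) X n = drop-length-++ P X n

take-length : ∀ {A : Set} (P X : List A) → take (length P) (P ++ X) ≡ P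
take-length []      X = refl
take-length (a ∷ P) X = cong (a ∷_) (take-length P X)

drop-length : ∀ {A : Set} (P X : List A) → drop (length P) (P ++ X) ≡ X
drop-length []      X = refl
drop-length (a ∷ P) X = drop-length P X

drop-++-≤ : ∀ {A : Set} k (u t : List A) → k ≤ length u → drop k (u ++ t) ≡ drop k u ++ t
drop-++-≤ zero    u       t _         = refl
drop-++-≤ (suc k) (a ∷ u) t (s≤s k≤u) = drop-++-≤ k u t k≤u

length-take-≤ : ∀ {A : Set} k (s : List A) → k ≤ length s → length (take k s) ≡ k
length-take-≤ k s k≤s = trans (length-take k s) (m≤n⇒m⊓n≡m k≤s)

popGT-pops : ∀ x y st → x < y →
  popGT x (y ∷ st) ≡ (cl ∷ proj₁ (popGT x st) , proj₂ (popGT x st))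
popGT-pops x y st x<y with x <ᵇ y in eq
... | true  = refl
... | false = ⊥-elim (subst IsTrue eq (<⇒<ᵇ x<y))

popGT-stops : ∀ x y st → ¬ x < y → popGT x (y ∷ st) ≡ ([] , y ∷ st)
popGT-stops x y st x≮y with x <ᵇ y in eq
... | true  = ⊥-elim (x≮y (<ᵇ⇒< x y (subst IsTrue (sym eq) _)))
... | false = refl

popGT-opens : ∀ x st → countOpen (proj₁ (popGT x st)) ≡ 0
popGT-opens x []       = refl
popGT-opens x (y ∷ st) with x <? y
... | yes x<y rewrite popGT-pops x y st x<y = popGT-opens x st
... | no  x≮y rewrite popGT-stops x y st x≮y = refl

run-∷ : ∀ st x xs →
  run st (x ∷ xs) ≡ proj₁ (popGT x st) ++ op ∷ run (x ∷ proj₂ (popGT x st)) xs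
run-∷ []       x xs = refl
run-∷ (y ∷ st) x xs with popGT x (y ∷ st)
... | (ps , st') = refl

run-pop : ∀ x st r rest → r < x → run (x ∷ st) (r ∷ rest) ≡ cl ∷ run st (r ∷ rest)
run-pop x st r rest r<x
  rewrite run-∷ (x ∷ st) r rest | popGT-pops r x st r<x | run-∷ st r rest = refl

run-push : ∀ x st y ys → ¬ y < x → run (x ∷ st) (y ∷ ys) ≡ op ∷ run (y ∷ x ∷ st) ys
run-push x st y ys y≮x rewrite run-∷ (x ∷ st) y ys | popGT-stops y x st y≮x = refl

data Head< (y : ℕ) : List ℕ → Set where
  none : Head< y []
  some : ∀ {z zs} → z < y → Head< y (z ∷ zs)

data SplitAtSmaller (y : ℕ) : List ℕ → Set where
  split : ∀ block after → All (λ a → ¬ a < y) block → Head< y after →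
          SplitAtSmaller y (block ++ after)

splitAtSmaller : ∀ y ys → SplitAtSmaller y ys
splitAtSmaller y [] = split [] [] [] none
splitAtSmaller y (a ∷ ys) with a <? y
... | yes a<y = split [] (a ∷ ys) [] (some a<y)
... | no  a≮y with splitAtSmaller y ys
...   | split block after ≥y hd = split (a ∷ block) after (a≮y ∷ ≥y) hd

Closes : ℕ → List ℕ → List ℕ → List ℕ → Set
Closes x st mid tl = Σ (List Paren) λ M → Balanced M × countOpen M ≡ length mid ×
  run (x ∷ st) (mid ++ tl) ≡ M ++ cl ∷ run st tl

nest : ∀ x st y b₁ b₂ tl → ¬ y < x →
  Closes y (x ∷ st) b₁ (b₂ ++ tl) → Closes x st b₂ tl → Closes x st (y ∷ b₁ ++ b₂) tl
nest x st y b₁ b₂ tl y≮x (M₁ , bal₁ , open₁ , run₁) (M₂ , bal₂ , open₂ , run₂) =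
  op ∷ M₁ ++ cl ∷ M₂ , wrap bal₁ bal₂ , opens , output
  where
  opens : countOpen (op ∷ M₁ ++ cl ∷ M₂) ≡ length (y ∷ b₁ ++ b₂)
  opens = cong suc (trans (countOpen-++ M₁ (cl ∷ M₂))
            (trans (cong₂ _+_ open₁ open₂) (sym (length-++ b₁))))
  output : run (x ∷ st) ((y ∷ b₁ ++ b₂) ++ tl) ≡ (op ∷ M₁ ++ cl ∷ M₂) ++ cl ∷ run st tl
  output = begin
    run (x ∷ st) (y ∷ (b₁ ++ b₂) ++ tl)   ≡⟨ run-push x st y ((b₁ ++ b₂) ++ tl) y≮x ⟩
    op ∷ run (y ∷ x ∷ st) ((b₁ ++ b₂) ++ tl)
      ≡⟨ cong (λ l → op ∷ run (y ∷ x ∷ st) l) (++-assoc b₁ b₂ tl) ⟩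
    op ∷ run (y ∷ x ∷ st) (b₁ ++ b₂ ++ tl) ≡⟨ cong (op ∷_) run₁ ⟩
    op ∷ M₁ ++ cl ∷ run (x ∷ st) (b₂ ++ tl) ≡⟨ cong (λ l → op ∷ M₁ ++ cl ∷ l) run₂ ⟩
    op ∷ M₁ ++ cl ∷ M₂ ++ cl ∷ run st tl   ≡⟨ cong (op ∷_) (sym (++-assoc M₁ (cl ∷ M₂) _)) ⟩
    (op ∷ M₁ ++ cl ∷ M₂) ++ cl ∷ run st tl ∎
    where open ≡-Reasoning

-- Induction on a bound for the length of mid:
-- the first value y of mid is closed at the next value smaller than y.
matching : ∀ bound x st mid r rest → length mid ≤ bound →
  All (λ a → ¬ a < x) mid → r < x → Closes x st mid (r ∷ rest)
matching bound x st [] r rest _ _ r<x = [] , empty , refl , run-pop x st r rest r<x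
matching (suc bound) x st (y ∷ mid) r rest (s≤s len≤) (y≮x ∷ mid≮x) r<x
  with splitAtSmaller y mid
... | split b₁ [] b₁≮y none =
  nest x st y b₁ [] _ y≮x
    (matching bound y (x ∷ st) b₁ r rest
       (≤-trans (m≤m+n (length b₁) 0) bound≥) b₁≮y (<-≤-trans r<x (≮⇒≥ y≮x)))
    (matching bound x st [] r rest z≤n [] r<x)
  where
  bound≥ : length b₁ + 0 ≤ bound
  bound≥ = subst (_≤ bound) (length-++ b₁) len≤
... | split b₁ (z ∷ b₂) b₁≮y (some z<y) =
  nest x st y b₁ (z ∷ b₂) _ y≮x
    (matching bound y (x ∷ st) b₁ z (b₂ ++ r ∷ rest)
       (≤-trans (m≤m+n (length b₁) _) bound≥) b₁≮y z<y)
    (matching bound x st (z ∷ b₂) r rest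
       (≤-trans (m≤n+m _ (length b₁)) bound≥) (++⁻ʳ b₁ mid≮x) r<x)
  where
  bound≥ : length b₁ + length (z ∷ b₂) ≤ bound
  bound≥ = subst (_≤ bound) (length-++ b₁) len≤

data EndsWithMin (l : ℕ) : List ℕ → Set where
  last : EndsWithMin l (l ∷ [])
  _∷_  : ∀ {a as} → l < a → EndsWithMin l as → EndsWithMin l (a ∷ as)

endsWithMin-last : ∀ {P : ℕ → Set} {l as} → EndsWithMin l as → All P as → P l
endsWithMin-last last      (p ∷ _)  = p
endsWithMin-last (_ ∷ ends) (_ ∷ ps) = endsWithMin-last ends ps

-- The minimum at the end lies below the first value y, so the values after y
-- cannot all be ≥ y.
endsWithMin-block : ∀ {l y a as} → EndsWithMin l (y ∷ a ∷ as) → ¬ All (λ b → ¬ b < y) (a ∷ as)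
endsWithMin-block (l<y ∷ ends) ≥y = endsWithMin-last ends ≥y l<y

endsWithMin-suffix : ∀ {l} pre z zs → EndsWithMin l (pre ++ z ∷ zs) → EndsWithMin l (z ∷ zs)
endsWithMin-suffix []            z zs ends       = ends
endsWithMin-suffix (a ∷ [])      z zs (_ ∷ ends) = ends
endsWithMin-suffix (a ∷ b ∷ pre) z zs (_ ∷ ends) = endsWithMin-suffix (b ∷ pre) z zs ends

WellFormed : List ℕ → Set
WellFormed ys = Balanced (run [] ys) × countOpen (run [] ys) ≡ length ys

wellFormed-closed : ∀ y b tl → Closes y [] b tl → WellFormed tl → WellFormed (y ∷ b ++ tl)
wellFormed-closed y b tl (M , balM , openM , runM) (balTl , openTl) =
  subst Balanced (sym output) (wrap balM balTl) ,
  trans (cong countOpen output)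
    (cong suc (trans (countOpen-++ M _) (trans (cong₂ _+_ openM openTl) (sym (length-++ b)))))
  where
  output : run [] (y ∷ b ++ tl) ≡ op ∷ M ++ cl ∷ run [] tl
  output = cong (op ∷_) runM

-- If the last value is the strict minimum, the output is well formed: the
-- first value y is closed at the next smaller value (which exists unless y is
-- the last value, closed by the final pop), and the rest is handled recursively.
run-wellFormed : ∀ bound ys {l} → length ys ≤ bound → EndsWithMin l ys → WellFormed ys
run-wellFormed (suc bound) (y ∷ ys) (s≤s len≤) ends with splitAtSmaller y ys
... | split [] [] _ none = wrap empty empty , refl
... | split (a ∷ b) [] b≮y none =
  ⊥-elim (endsWithMin-block ends (subst (All _) (sym (++-identityʳ (a ∷ b))) b≮y))
... | split b (z ∷ zs) b≮y (some z<y) =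
  wellFormed-closed y b (z ∷ zs)
    (matching bound y [] b z zs (≤-trans (m≤m+n (length b) _) bound≥) b≮y z<y)
    (run-wellFormed bound (z ∷ zs) (≤-trans (m≤n+m _ (length b)) bound≥)
      (endsWithMin-suffix (y ∷ b) z zs ends))
  where
  bound≥ : length b + length (z ∷ zs) ≤ bound
  bound≥ = subst (_≤ bound) (length-++ b) len≤

runPrefix : List ℕ → List ℕ → List Paren × List ℕ
runPrefix st []       = [] , st
runPrefix st (x ∷ xs) =
  proj₁ (popGT x st) ++ op ∷ proj₁ (runPrefix (x ∷ proj₂ (popGT x st)) xs) ,
  proj₂ (runPrefix (x ∷ proj₂ (popGT x st)) xs)

run-++ : ∀ st xs ys → run st (xs ++ ys) ≡ proj₁ (runPrefix st xs) ++ run (proj₂ (runPrefix st xs)) ys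
run-++ st []       ys = refl
run-++ st (x ∷ xs) ys = trans (run-∷ st x (xs ++ ys))
  (trans (cong (λ l → proj₁ (popGT x st) ++ op ∷ l) (run-++ (x ∷ proj₂ (popGT x st)) xs ys))
    (sym (++-assoc (proj₁ (popGT x st)) _ _)))

runPrefix-opens : ∀ st xs → countOpen (proj₁ (runPrefix st xs)) ≡ length xs
runPrefix-opens st []       = refl
runPrefix-opens st (x ∷ xs) = trans (countOpen-++ (proj₁ (popGT x st)) _)
  (cong₂ _+_ (popGT-opens x st) (cong suc (runPrefix-opens _ xs)))

Encloses : List Paren → ℕ → ℕ → Set
Encloses S i k = Σ (List Paren) λ P → Σ (List Paren) λ M → Σ (List Paren) λ Q →
  (S ≡ P ++ op ∷ M ++ cl ∷ Q) × countOpen P ≡ i × Balanced M × countOpen M ≡ k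

data ClosedBy (x : ℕ) : List ℕ → List ℕ → Set where
  smaller : ∀ {mid r rest} → r < x → ClosedBy x mid (r ∷ rest)
  atEnd   : ClosedBy x [] []

closedAfter : ∀ x st mid rest → All (λ a → ¬ a < x) mid → ClosedBy x mid rest →
  Σ (List Paren) λ M → Σ (List Paren) λ Q →
    Balanced M × countOpen M ≡ length mid × run (x ∷ st) (mid ++ rest) ≡ M ++ cl ∷ Q
closedAfter x st mid (r ∷ rest) mid≮x (smaller r<x)
  with matching (length mid) x st mid r rest ≤-refl mid≮x r<x
... | (M , balM , openM , runM) = M , run st (r ∷ rest) , balM , openM , runM
closedAfter x st [] [] [] atEnd = [] , [] , empty , refl , refl

encloses : ∀ pre x mid rest → All (λ a → ¬ a < x) mid → ClosedBy x mid rest →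
  Encloses (run [] (pre ++ x ∷ mid ++ rest)) (length pre) (length mid)
encloses pre x mid rest mid≮x closed
  with closedAfter x (proj₂ (popGT x (proj₂ (runPrefix [] pre)))) mid rest mid≮x closed
... | (M , Q , balM , openM , runM) = P , M , Q , output , opensP , balM , openM
  where
  before = proj₁ (runPrefix [] pre)
  stack = proj₂ (runPrefix [] pre)
  P = before ++ proj₁ (popGT x stack)
  output : run [] (pre ++ x ∷ mid ++ rest) ≡ P ++ op ∷ M ++ cl ∷ Q
  output = begin
    run [] (pre ++ x ∷ mid ++ rest)                          ≡⟨ run-++ [] pre _ ⟩
    before ++ run stack (x ∷ mid ++ rest)                    ≡⟨ cong (before ++_) (run-∷ stack x (mid ++ rest)) ⟩
    before ++ proj₁ (popGT x stack) ++ op ∷ run (x ∷ proj₂ (popGT x stack)) (mid ++ rest)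
      ≡⟨ sym (++-assoc before _ _) ⟩
    P ++ op ∷ run (x ∷ proj₂ (popGT x stack)) (mid ++ rest) ≡⟨ cong (λ l → P ++ op ∷ l) runM ⟩
    P ++ op ∷ M ++ cl ∷ Q                                    ∎
    where open ≡-Reasoning
  opensP : countOpen P ≡ length pre
  opensP = trans (countOpen-++ before _)
    (trans (cong₂ _+_ (runPrefix-opens [] pre) (popGT-opens x stack)) (+-identityʳ _))

-- Reading off positions: if the (i+1)-th '(' encloses a balanced block with k
-- '(', then it sits at o = |P|+1, its match at c = |P|+2k+2, and (c-o+1)/2 = k+1.
Selected : List Paren → ℕ → ℕ → Set
Selected S i ℓ = Σ ℕ λ o → Σ ℕ λ c →
  SelectOpen S (suc i) o × SelectClose S (suc i) c × (c ∸ o + 1) / 2 ≡ ℓ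

select-enclosed : ∀ S i k → Encloses S i k → Selected S i (suc k)
select-enclosed S i k (P , M , Q , refl , openP , balM , openM) =
  o , c , selOpen , (o , selOpen , atO , atC , o<c , inside) , halfWidth
  where
  o = length P + 1
  c = length P + suc (suc (length M))
  atO : at (P ++ op ∷ M ++ cl ∷ Q) o ≡ just op
  atO = at-++ P _ 0
  selOpen : SelectOpen (P ++ op ∷ M ++ cl ∷ Q) (suc i) o
  selOpen = atO , (begin
    countOpen (take (length P + 1) (P ++ op ∷ M ++ cl ∷ Q)) ≡⟨ cong countOpen (take-length-++ P _ 1) ⟩
    countOpen (P ++ op ∷ [])                              ≡⟨ countOpen-++ P (op ∷ []) ⟩
    countOpen P + 1                                       ≡⟨ cong (_+ 1) openP ⟩
    i + 1                                                 ≡⟨ +-comm i 1 ⟩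
    suc i                                                 ∎)
    where open ≡-Reasoning
  atC : at (P ++ op ∷ M ++ cl ∷ Q) c ≡ just cl
  atC = trans (at-++ P _ (suc (length M)))
          (trans (cong (at (M ++ cl ∷ Q)) (+-comm 1 (length M))) (at-++ M (cl ∷ Q) 0))
  o<c : o < c
  o<c = +-monoʳ-< (length P) (s≤s (s≤s z≤n))
  width : c ∸ o ≡ suc (length M)
  width = [m+n]∸[m+o]≡n∸o (length P) (suc (suc (length M))) 1
  inside : Balanced (take (c ∸ o ∸ 1) (drop o (P ++ op ∷ M ++ cl ∷ Q)))
  inside rewrite width | drop-length-++ P (op ∷ M ++ cl ∷ Q) 1 | take-length M (cl ∷ Q) = balM
  lengthM : length M ≡ k * 2
  lengthM = begin
    length M                      ≡⟨ length≡opens+closes M ⟩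
    countOpen M + countClose M    ≡⟨ cong (countOpen M +_) (sym (balanced⇒opens≡closes balM)) ⟩
    countOpen M + countOpen M     ≡⟨ cong₂ _+_ openM openM ⟩
    k + k                         ≡⟨ cong (k +_) (sym (+-identityʳ k)) ⟩
    2 * k                         ≡⟨ *-comm 2 k ⟩
    k * 2                         ∎
    where open ≡-Reasoning
  halfWidth : (c ∸ o + 1) / 2 ≡ suc k
  halfWidth = begin
    (c ∸ o + 1) / 2          ≡⟨ cong (λ w → (w + 1) / 2) width ⟩
    (suc (length M) + 1) / 2 ≡⟨ cong (_/ 2) (+-comm (suc (length M)) 1) ⟩
    suc (suc (length M)) / 2 ≡⟨ cong (λ w → suc (suc w) / 2) lengthM ⟩
    suc k * 2 / 2            ≡⟨ m*n/n≡m (suc k) 2 ⟩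
    suc k                    ∎
    where open ≡-Reasoning

range : ℕ → ℕ → List ℕ
range a zero    = []
range a (suc l) = a ∷ range (suc a) l

upTo≡range : ∀ n → upTo n ≡ range 0 n
upTo≡range n = shifted (λ k → k) 0 n (λ _ → refl)
  where
  shifted : ∀ (g : ℕ → ℕ) a l → (∀ k → g k ≡ a + k) → applyUpTo g l ≡ range a l
  shifted g a zero    g≗ = refl
  shifted g a (suc l) g≗ = cong₂ _∷_ (trans (g≗ 0) (+-identityʳ a))
    (shifted (λ k → g (suc k)) (suc a) l (λ k → trans (g≗ (suc k)) (+-suc a k)))

range-++ : ∀ a k l → range a (k + l) ≡ range a k ++ range (a + k) l
range-++ a zero    l = cong (λ b → range b l) (sym (+-identityʳ a))
range-++ a (suc k) l = cong (a ∷_) (trans (range-++ (suc a) k l)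
  (cong (λ b → range (suc a) k ++ range b l) (sym (+-suc a k))))

length-range : ∀ a l → length (range a l) ≡ l
length-range a zero    = refl
length-range a (suc l) = cong suc (length-range (suc a) l)

all-range : ∀ {P : ℕ → Set} a l → (∀ k → a ≤ k → k < a + l → P k) → All P (range a l)
all-range a zero    h = []
all-range a (suc l) h = h a ≤-refl (m<m+n a z<s) ∷
  all-range (suc a) l (λ k a<k k< → h k (<⇒≤ a<k) (subst (k <_) (sym (+-suc a l)) k<))

upTo-around : ∀ {i j n} → i < j → j ≤ n →
  upTo n ≡ range 0 i ++ i ∷ range (suc i) (j ∸ suc i) ++ range j (n ∸ j)
upTo-around {i} {j} {n} i<j j≤n = begin
  upTo n                                          ≡⟨ upTo≡range n ⟩
  range 0 n                                       ≡⟨ cong (range 0) (sym total) ⟩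
  range 0 (i + suc (a + b))                       ≡⟨ range-++ 0 i (suc (a + b)) ⟩
  range 0 i ++ i ∷ range (suc i) (a + b)          ≡⟨ cong (λ l → range 0 i ++ i ∷ l) (range-++ (suc i) a b) ⟩
  range 0 i ++ i ∷ range (suc i) a ++ range (suc i + a) b
    ≡⟨ cong (λ c → range 0 i ++ i ∷ range (suc i) a ++ range c b) (m+[n∸m]≡n i<j) ⟩
  range 0 i ++ i ∷ range (suc i) a ++ range j b   ∎
  where
  open ≡-Reasoning
  a = j ∸ suc i
  b = n ∸ j
  total : i + suc (a + b) ≡ n
  total = begin
    i + suc (a + b)   ≡⟨ +-suc i (a + b) ⟩
    suc (i + (a + b)) ≡⟨ cong suc (sym (+-assoc i a b)) ⟩
    suc i + a + b     ≡⟨ cong (_+ b) (m+[n∸m]≡n i<j) ⟩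
    j + b             ≡⟨ m+[n∸m]≡n j≤n ⟩
    n                 ∎

Least : (ℕ → Set) → ℕ → ℕ → Set
Least P a l = Σ ℕ λ j → a ≤ j × j ≤ a + l × (j < a + l → P j) × (∀ k → a ≤ k → k < j → ¬ P k)

least : {P : ℕ → Set} → (∀ k → Dec (P k)) → ∀ a l → Least P a l
least P? a zero =
  a , ≤-refl , m≤m+n a 0 , (λ a<a → ⊥-elim (<-irrefl (sym (+-identityʳ a)) a<a)) ,
  (λ k a≤k k<a → ⊥-elim (<-irrefl refl (≤-<-trans a≤k k<a)))
least {P} P? a (suc l) with P? a
... | yes pa =
  a , ≤-refl , m≤m+n a _ , (λ _ → pa) , (λ k a≤k k<a → ⊥-elim (<-irrefl refl (≤-<-trans a≤k k<a)))
... | no ¬pa with least P? (suc a) l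
... | (j , a<j , j≤ , pj , below) =
  j , <⇒≤ a<j , subst (j ≤_) (sym (+-suc a l)) j≤ , (λ j< → pj (subst (j <_) (+-suc a l) j<)) , below'
  where
  below' : ∀ k → a ≤ k → k < j → ¬ P k
  below' k a≤k k<j with k ≟ a
  ... | yes refl = ¬pa
  ... | no  k≢a  = below k (≤∧≢⇒< a≤k (λ a≡k → k≢a (sym a≡k))) k<j

-- The procedure on the values f 0, …, f m (n = m + 1 of them), whose last
-- value f m is the strict minimum (as the rank of the sentinel suffix is).
-- The '(' of position i is closed exactly when the next smaller value is read.
module NextSmaller (f : ℕ → ℕ) (n m : ℕ) (n≡ : n ≡ suc m) (f-min : ∀ k → k < m → f m < f k) where

  S : List Paren
  S = run [] (map f (upTo n))

  wellFormed : WellFormed (map f (upTo n))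
  wellFormed = run-wellFormed _ _ ≤-refl
    (subst (EndsWithMin (f m) ∘ map f) (sym (trans (upTo≡range n) (cong (range 0) n≡))) (ending 0 m refl))
    where
    ending : ∀ a l → a + l ≡ m → EndsWithMin (f m) (map f (range a (suc l)))
    ending a zero    a+0≡m =
      subst (λ b → EndsWithMin (f m) (f b ∷ [])) (sym (trans (sym (+-identityʳ a)) a+0≡m)) last
    ending a (suc l) a+l≡m =
      f-min a (subst (a <_) a+l≡m (m<m+n a z<s)) ∷ ending (suc a) l (trans (sym (+-suc a l)) a+l≡m)

  IsNextSmaller : ℕ → ℕ → Set
  IsNextSmaller i j = i < j × j ≤ n × (j < n → f j < f i) × (∀ k → i < k → k < j → ¬ f k < f i)

  nextSmaller : ∀ i → i < n → Σ ℕ (IsNextSmaller i)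
  nextSmaller i i<n with least (λ k → f k <? f i) (suc i) (m ∸ i)
  ... | (j , i<j , j≤ , fj<fi , below) =
    j , i<j , subst (j ≤_) end j≤ , (λ j< → fj<fi (subst (j <_) (sym end) j<)) , below
    where
    end : suc i + (m ∸ i) ≡ n
    end = trans (cong suc (m+[n∸m]≡n (s≤s⁻¹ (subst (i <_) n≡ i<n)))) (sym n≡)

  -- The value f i is closed by f j, or j = n and nothing lies after f i
  -- (a value between i and n would be a smaller value, namely f m).
  closedBy : ∀ {i j} → IsNextSmaller i j →
    ClosedBy (f i) (map f (range (suc i) (j ∸ suc i))) (map f (range j (n ∸ j)))
  closedBy {i} {j} (i<j , j≤n , fj<fi , below) with n ∸ j in gap
  ... | suc _ = smaller (fj<fi (m∸n≢0⇒n<m (λ gap≡0 → 0≢1+n (trans (sym gap≡0) gap))))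
  ... | zero with j ∸ suc i in inner
  ...   | zero  = atEnd
  ...   | suc _ = ⊥-elim (below m i<m m<j (f-min i i<m))
    where
    j≡n : j ≡ suc m
    j≡n = trans (≤-antisym j≤n (m∸n≡0⇒m≤n gap)) n≡
    m<j : m < j
    m<j = subst (m <_) (sym j≡n) ≤-refl
    i<m : i < m
    i<m = s≤s⁻¹ (subst (suc i <_) j≡n (m∸n≢0⇒n<m (λ inner≡0 → 0≢1+n (trans (sym inner≡0) inner))))

  selected : ∀ {i j} → IsNextSmaller i j → Selected S i (j ∸ i)
  selected {i} {j} ns@(i<j , j≤n , _ , below) =
    subst₂ (Selected S) (length-segment 0 i)
      (trans (cong suc (length-segment (suc i) (j ∸ suc i))) (sym (+-∸-assoc 1 i<j)))
      (select-enclosed S _ _ (subst (λ T → Encloses T _ _) (sym (cong (run []) layout))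
        (encloses pre (f i) mid rest (map⁺ (all-range (suc i) (j ∸ suc i) inside)) (closedBy ns))))
    where
    pre = map f (range 0 i)
    mid = map f (range (suc i) (j ∸ suc i))
    rest = map f (range j (n ∸ j))
    length-segment : ∀ a l → length (map f (range a l)) ≡ l
    length-segment a l = trans (length-map f (range a l)) (length-range a l)
    layout : map f (upTo n) ≡ pre ++ f i ∷ mid ++ rest
    layout = begin
      map f (upTo n)                                ≡⟨ cong (map f) (upTo-around i<j j≤n) ⟩
      map f (range 0 i ++ i ∷ range (suc i) (j ∸ suc i) ++ range j (n ∸ j))
        ≡⟨ map-++ f (range 0 i) _ ⟩
      pre ++ f i ∷ map f (range (suc i) (j ∸ suc i) ++ range j (n ∸ j))
        ≡⟨ cong (λ l → pre ++ f i ∷ l) (map-++ f (range (suc i) (j ∸ suc i)) _) ⟩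
      pre ++ f i ∷ mid ++ rest                      ∎
      where open ≡-Reasoning
    inside : ∀ k → suc i ≤ k → k < suc i + (j ∸ suc i) → ¬ f k < f i
    inside k i<k k< = below k i<k (subst (k <_) (m+[n∸m]≡n i<j) k<)

module LexOrder {A : Set} {_≺_ : Rel A 0ℓ} (sto : IsStrictTotalOrder _≡_ _≺_) where
  open IsStrictTotalOrder sto using () renaming (irrefl to ≺-irrefl)

  _<L_ : Rel (List A) 0ℓ
  _<L_ = _⊏_ _≺_

  private
    module L = IsStrictTotalOrder (Lex.<-isStrictTotalOrder sto)

  <L-trans : ∀ {x y z} → x <L y → y <L z → x <L z
  <L-trans = L.trans

  <L-asym : ∀ {x y} → x <L y → ¬ y <L x
  <L-asym = L.asym

  <L-irrefl : ∀ {x} → ¬ x <L x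
  <L-irrefl x<x = <L-asym x<x x<x

  <L-trichotomy : ∀ x y → x <L y ⊎ x ≡ y ⊎ y <L x
  <L-trichotomy x y with L.compare x y
  ... | tri< x<y _ _ = inj₁ x<y
  ... | tri≈ _ x≋y _ = inj₂ (inj₁ (Pointwise-≡⇒≡ x≋y))
  ... | tri> _ _ y<x = inj₂ (inj₂ y<x)

  cancel-prefix : ∀ (c x y : List A) → (c ++ x) <L (c ++ y) → x <L y
  cancel-prefix []      x y lt          = lt
  cancel-prefix (a ∷ c) x y (this a≺a)  = ⊥-elim (≺-irrefl refl a≺a)
  cancel-prefix (a ∷ c) x y (next _ lt) = cancel-prefix c x y lt

  compare-same-length : ∀ (u y a b : List A) → length u ≡ length y → (u ++ a) <L (y ++ b) →
    (u <L y) ⊎ (u ≡ y × a <L b)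
  compare-same-length []      []      a b _ lt          = inj₂ (refl , lt)
  compare-same-length (x ∷ u) (z ∷ y) a b _ (this x≺z)  = inj₁ (this x≺z)
  compare-same-length (x ∷ u) (z ∷ y) a b e (next refl lt)
    with compare-same-length u y a b (suc-injective e) lt
  ... | inj₁ u<y          = inj₁ (next refl u<y)
  ... | inj₂ (refl , a<b) = inj₂ (refl , a<b)

  compare-shorter : ∀ (u v t : List A) → length v < length u → (u ++ t) <L (v ++ t) →
    (∀ y z → (u ++ y) <L (v ++ z)) ⊎ (Σ (List A) λ z → u ≡ v ++ z × (z ++ t) <L t)
  compare-shorter u       []      t _ lt = inj₂ (u , refl , lt)
  compare-shorter (a ∷ u) (b ∷ v) t _ (this a≺b) = inj₁ (λ y z → this a≺b)
  compare-shorter (a ∷ u) (b ∷ v) t (s≤s |v|<|u|) (next refl lt) with compare-shorter u v t |v|<|u| lt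
  ... | inj₁ decided          = inj₁ (λ y z → next refl (decided y z))
  ... | inj₂ (z , u≡ , z++t<t) = inj₂ (z , cong (a ∷_) u≡ , z++t<t)

  compare-prefixes : ∀ (p r : List A) q → p <L r → q ≤ length p →
    (take q p ≡ take q r) ⊎ (∀ a b → (take q p ++ a) <L (take q r ++ b))
  compare-prefixes p       r       zero    lt         _ = inj₁ refl
  compare-prefixes (x ∷ p) (y ∷ r) (suc q) (this x≺y) _ = inj₂ (λ a b → this x≺y)
  compare-prefixes (x ∷ p) (y ∷ r) (suc q) (next refl lt) (s≤s q≤p) with compare-prefixes p r q lt q≤p
  ... | inj₁ same    = inj₁ (cong (x ∷_) same)
  ... | inj₂ decided = inj₂ (λ a b → next refl (decided a b))

  lyndon<rotation : ∀ {w} u v → Lyndon _≺_ w → w ≡ u ++ v → 0 < length u → 0 < length v →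
    w <L (v ++ u)
  lyndon<rotation u v (_ , below-rotations) refl 0<u 0<v =
    subst ((u ++ v) <L_) (cong₂ _++_ (drop-length u v) (take-length u v))
      (below-rotations (length u) 0<u (subst (length u <_) (sym (length-++ u)) (m<m+n (length u) 0<v)))

  lyndon-unbordered : ∀ {w} u v y → Lyndon _≺_ w → w ≡ u ++ v → w ≡ v ++ y →
    0 < length u → 0 < length v → ⊥
  lyndon-unbordered u v y ly w≡uv w≡vy 0<u 0<v
    with compare-same-length u y v v |u|≡|y| (subst (_<L (y ++ v)) w≡uv (lyndon<rotation v y ly w≡vy 0<v 0<y))
    where
    |u|≡|y| : length u ≡ length y
    |u|≡|y| = +-cancelˡ-≡ (length v) _ _ (begin
      length v + length u ≡⟨ +-comm (length v) (length u) ⟩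
      length u + length v ≡⟨ sym (length-++ u) ⟩
      length (u ++ v)     ≡⟨ cong length (trans (sym w≡uv) w≡vy) ⟩
      length (v ++ y)     ≡⟨ length-++ v ⟩
      length v + length y ∎)
      where open ≡-Reasoning
    0<y : 0 < length y
    0<y = subst (0 <_) |u|≡|y| 0<u
  ... | inj₁ u<y       = <L-asym u<y y<u
    where
    y<u : y <L u
    y<u = cancel-prefix v y u (subst (_<L (v ++ u)) w≡vy (lyndon<rotation u v ly w≡uv 0<u 0<v))
  ... | inj₂ (_ , v<v) = <L-irrefl v<v

  module LyndonPrefix (s : List A) (L : ℕ) (0<L : 0 < L) (L≤s : L ≤ length s)
                      (suffix<s : drop L s <L s) where
    u = take L s
    t = drop L s

    s≡ut : s ≡ u ++ t
    s≡ut = sym (take++drop≡id L s)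

    |u|≡L : length u ≡ L
    |u|≡L = length-take-≤ L s L≤s

    -- For a rotation at 0 < k < L, compare
    -- s = u ++ t with its suffix drop k u ++ t: either the comparison is decided
    -- before drop k u ends, or drop k u is a prefix of u and the suffix of s after it lies
    -- between s and t, contradicting t < s.
    lyndon : (∀ k → 0 < k → k < L → s <L drop k s) → Lyndon _≺_ u
    lyndon s<suffix = subst (0 <_) (sym |u|≡L) 0<L , rotation
      where
      rotation : ∀ k → 0 < k → k < length u → u <L (drop k u ++ take k u)
      rotation k 0<k k<u = conclude (compare-shorter u v t |v|<|u| s<suffix′)
        where
        v = drop k u
        p = length v
        k<L : k < L
        k<L = subst (k <_) |u|≡L k<u
        |v|≡ : p ≡ L ∸ k
        |v|≡ = trans (length-drop k u) (cong (_∸ k) |u|≡L)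
        0<p : 0 < p
        0<p = subst (0 <_) (sym |v|≡) (m<n⇒0<n∸m k<L)
        p<L : p < L
        p<L = subst (_< L) (sym |v|≡) (∸-monoʳ-< 0<k (<⇒≤ k<L))
        |v|<|u| : p < length u
        |v|<|u| = subst (p <_) (sym |u|≡L) p<L
        s<suffix′ : (u ++ t) <L (v ++ t)
        s<suffix′ = subst₂ _<L_ s≡ut (trans (cong (drop k) s≡ut) (drop-++-≤ k u t (<⇒≤ k<u)))
                      (s<suffix k 0<k k<L)
        conclude : (∀ y z → (u ++ y) <L (v ++ z)) ⊎ (Σ (List A) λ z → u ≡ v ++ z × (z ++ t) <L t) →
                   u <L (v ++ take k u)
        conclude (inj₁ decided) = subst (_<L (v ++ take k u)) (++-identityʳ u) (decided [] (take k u))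
        conclude (inj₂ (z , u≡vz , zt<t)) =
          ⊥-elim (<L-asym (<L-trans (s<suffix p 0<p p<L) (subst (_<L t) (sym drop-p) zt<t)) suffix<s)
          where
          drop-p : drop p s ≡ z ++ t
          drop-p = trans (cong (drop p) (trans s≡ut (trans (cong (_++ t) u≡vz) (++-assoc v z t))))
                     (drop-length v (z ++ t))

    -- No longer prefix w = u ++ t' is Lyndon: as t < s, either t' is a border
    -- of w, or the rotation t' ++ u is smaller than w.
    no-longer : ∀ m → L < m → m ≤ length s → ¬ Lyndon _≺_ (take m s)
    no-longer m L<m m≤s ly = conclude (compare-prefixes t s q suffix<s q≤t)
      where
      q = m ∸ L
      w = take m s
      t′ = take q t
      q≤t : q ≤ length t
      q≤t = subst (q ≤_) (sym (length-drop L s)) (∸-monoˡ-≤ L m≤s)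
      0<u : 0 < length u
      0<u = subst (0 <_) (sym |u|≡L) 0<L
      0<t′ : 0 < length t′
      0<t′ = subst (0 <_) (sym (length-take-≤ q t q≤t)) (m<n⇒0<n∸m L<m)
      w≡ut′ : w ≡ u ++ t′
      w≡ut′ = begin
        take m s                  ≡⟨ cong₂ take (sym (m+[n∸m]≡n (<⇒≤ L<m))) s≡ut ⟩
        take (L + q) (u ++ t)     ≡⟨ cong (λ l → take (l + q) (u ++ t)) (sym |u|≡L) ⟩
        take (length u + q) (u ++ t) ≡⟨ take-length-++ u t q ⟩
        u ++ t′                   ∎
        where open ≡-Reasoning
      take-q-w : take q w ≡ take q s
      take-q-w = trans (take-take q m s) (cong (λ l → take l s) (m≤n⇒m⊓n≡m (m∸n≤m m L)))
      conclude : (take q t ≡ take q s) ⊎ (∀ a b → (take q t ++ a) <L (take q s ++ b)) → ⊥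
      conclude (inj₁ same)    = lyndon-unbordered u t′ (drop q w) ly w≡ut′ w≡t′y 0<u 0<t′
        where
        w≡t′y : w ≡ t′ ++ drop q w
        w≡t′y = trans (sym (take++drop≡id q w)) (cong (_++ drop q w) (trans take-q-w (sym same)))
      conclude (inj₂ decided) = <L-asym (lyndon<rotation u t′ ly w≡ut′ 0<u 0<t′)
        (subst ((t′ ++ u) <L_) (trans (cong (_++ drop q w) (sym take-q-w)) (take++drop≡id q w))
          (decided u (drop q w)))

    longest : (∀ k → 0 < k → k < L → s <L drop k s) → LongestLyndon _≺_ s 0 L
    longest s<suffix = L≤s , lyndon s<suffix , maximal
      where
      maximal : ∀ m → m ≤ length s → Lyndon _≺_ (take m s) → m ≤ L
      maximal m m≤s ly with m ≤? L
      ... | yes m≤L = m≤L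
      ... | no  m≰L = ⊥-elim (no-longer m (≰⇒> m≰L) m≤s ly)

module FilterCount {P Q : ℕ → Set} (P? : Decidable P) (Q? : Decidable Q) (P⇒Q : ∀ x → P x → Q x) where
  filter-≤ : ∀ xs → length (filter P? xs) ≤ length (filter Q? xs)
  filter-≤ [] = z≤n
  filter-≤ (y ∷ xs) with P? y | Q? y
  ... | yes _  | yes _  = s≤s (filter-≤ xs)
  ... | yes py | no ¬qy = ⊥-elim (¬qy (P⇒Q y py))
  ... | no _   | yes _  = m≤n⇒m≤1+n (filter-≤ xs)
  ... | no _   | no _   = filter-≤ xs

  filter-< : ∀ xs x → x ∈ xs → Q x → ¬ P x → length (filter P? xs) < length (filter Q? xs)
  filter-< (y ∷ xs) .y (here refl) qy ¬py with P? y | Q? y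
  ... | yes py | _      = ⊥-elim (¬py py)
  ... | no _   | yes _  = s≤s (filter-≤ xs)
  ... | no _   | no ¬qy = ⊥-elim (¬qy qy)
  filter-< (y ∷ xs) x (there x∈xs) qx ¬px with P? y | Q? y
  ... | yes _  | yes _  = s≤s (filter-< xs x x∈xs qx ¬px)
  ... | yes py | no ¬qy = ⊥-elim (¬qy (P⇒Q y py))
  ... | no _   | yes _  = m≤n⇒m≤1+n (filter-< xs x x∈xs qx ¬px)
  ... | no _   | no _   = filter-< xs x x∈xs qx ¬px

module Ranks {A : Set} {_≺_ : Rel A 0ℓ} (sto : IsStrictTotalOrder _≡_ _≺_) where
  open LexOrder sto

  -- Ranks are strictly monotone in the suffix order: suffix a itself is
  -- counted below suffix b but not below suffix a.
  rank-mono : ∀ T a b → a < length T → drop a T <L drop b T → ISA sto T a < ISA sto T b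
  rank-mono T a b a<T a<b = s≤s (filter-< (upTo (length T)) a (∈-upTo⁺ a<T) a<b <L-irrefl)
    where
    open FilterCount (λ j → _⊏?_ sto (drop j T) (drop a T)) (λ j → _⊏?_ sto (drop j T) (drop b T))
                     (λ _ j<a → <L-trans j<a a<b)

  drop-injective : ∀ (T : List A) a b → a ≤ length T → b ≤ length T → drop a T ≡ drop b T → a ≡ b
  drop-injective T a b a≤T b≤T same =
    ∸-cancelˡ-≡ a≤T b≤T (trans (sym (length-drop a T)) (trans (cong length same) (length-drop b T)))

  rank<⇒suffix< : ∀ T a b → a < length T → b < length T →
    ISA sto T a < ISA sto T b → drop a T <L drop b T
  rank<⇒suffix< T a b a<T b<T ra<rb with <L-trichotomy (drop a T) (drop b T)
  ... | inj₁ a<b        = a<b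
  ... | inj₂ (inj₁ a≡b) rewrite drop-injective T a b (<⇒≤ a<T) (<⇒≤ b<T) a≡b =
    ⊥-elim (<-irrefl refl ra<rb)
  ... | inj₂ (inj₂ b<a) = ⊥-elim (<-asym ra<rb (rank-mono T b a b<T b<a))

  rank≮⇒suffix> : ∀ T a b → a < length T → b < length T → a ≢ b →
    ¬ ISA sto T a < ISA sto T b → drop b T <L drop a T
  rank≮⇒suffix> T a b a<T b<T a≢b ra≮rb with <L-trichotomy (drop a T) (drop b T)
  ... | inj₁ a<b        = ⊥-elim (ra≮rb (rank-mono T a b a<T a<b))
  ... | inj₂ (inj₁ a≡b) = ⊥-elim (a≢b (drop-injective T a b (<⇒≤ a<T) (<⇒≤ b<T) a≡b))
  ... | inj₂ (inj₂ b<a) = b<a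

  sentinel-least : ∀ w d → All (d ≺_) w → ∀ k → k < length w →
    ISA sto (w ++ d ∷ []) (length w) < ISA sto (w ++ d ∷ []) k
  sentinel-least w d d≺w k k<w =
    rank-mono T (length w) k |w|<T (subst (_<L drop k T) (sym (drop-length w (d ∷ []))) (d<suffix w k d≺w k<w))
    where
    T = w ++ d ∷ []
    |w|<T : length w < length T
    |w|<T = subst (length w <_) (sym (length-++ w)) (m<m+n (length w) (s≤s z≤n))
    d<suffix : ∀ w k → All (d ≺_) w → k < length w → (d ∷ []) <L drop k (w ++ d ∷ [])
    d<suffix (a ∷ w) zero    (d≺a ∷ _)  _         = this d≺a
    d<suffix (a ∷ w) (suc k) (_ ∷ d≺w) (s≤s k<w) = d<suffix w k d≺w k<w

  longestLyndon-suffix : ∀ T i ℓ → LongestLyndon _≺_ (drop i T) 0 ℓ → LongestLyndon _≺_ T i ℓ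
  longestLyndon-suffix T i ℓ (ℓ≤ , ly , maximal) =
    subst (ℓ ≤_) (length-drop i T) ℓ≤ , ly ,
    λ m m≤ → maximal m (subst (m ≤_) (sym (length-drop i T)) m≤)

  nonempty-suffix : ∀ (T : List A) i → i < length T → [] <L drop i T
  nonempty-suffix (x ∷ T) zero    _         = halt
  nonempty-suffix (x ∷ T) (suc i) (s≤s i<T) = nonempty-suffix T i i<T

  longestLyndon-nextSmaller : ∀ T i j → i < j → j ≤ length T →
    (j < length T → ISA sto T j < ISA sto T i) → (∀ k → i < k → k < j → ¬ ISA sto T k < ISA sto T i) →
    LongestLyndon _≺_ T i (j ∸ i)
  longestLyndon-nextSmaller T i j i<j j≤T rj<ri below =
    longestLyndon-suffix T i L (LyndonPrefix.longest (drop i T) L (m<n⇒0<n∸m i<j) L≤s suffix<s s<suffix)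
    where
    L = j ∸ i
    i<T = <-≤-trans i<j j≤T
    drop-in-suffix : ∀ k → drop k (drop i T) ≡ drop (i + k) T
    drop-in-suffix k = drop-drop i k T
    L≤s : L ≤ length (drop i T)
    L≤s = subst (L ≤_) (sym (length-drop i T)) (∸-monoˡ-≤ i j≤T)
    suffix-j<suffix-i : drop j T <L drop i T
    suffix-j<suffix-i with j <? length T
    ... | yes j<T = rank<⇒suffix< T j i j<T i<T (rj<ri j<T)
    ... | no  j≮T = subst (_<L drop i T) (sym (drop-all j T (≮⇒≥ j≮T))) (nonempty-suffix T i i<T)
    suffix<s : drop L (drop i T) <L drop i T
    suffix<s = subst (_<L drop i T)
      (sym (trans (drop-in-suffix L) (cong (λ p → drop p T) (m+[n∸m]≡n (<⇒≤ i<j))))) suffix-j<suffix-i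
    s<suffix : ∀ k → 0 < k → k < L → drop i T <L drop k (drop i T)
    s<suffix k 0<k k<L = subst (drop i T <L_) (sym (drop-in-suffix k))
      (rank≮⇒suffix> T (i + k) i (<-≤-trans i+k<j j≤T) i<T (λ i+k≡i → <-irrefl (sym i+k≡i) i<i+k)
        (below (i + k) i<i+k i+k<j))
      where
      i<i+k : i < i + k
      i<i+k = m<m+n i 0<k
      i+k<j : i + k < j
      i+k<j = subst (i + k <_) (m+[n∸m]≡n (<⇒≤ i<j)) (+-monoʳ-< i k<L)

lemma3 : {A : Set} {_≺_ : Rel A 0ℓ} (sto : IsStrictTotalOrder _≡_ _≺_)
    (w : List A) (d : A) → All (λ a → ¬ a ≡ d) w → All (λ a → d ≺ a) w →
    Balanced (λBP sto (w ++ d ∷ []))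
    × countOpen (λBP sto (w ++ d ∷ [])) ≡ length (w ++ d ∷ [])
    × countClose (λBP sto (w ++ d ∷ [])) ≡ length (w ++ d ∷ [])
    × ((i : Fin (length (w ++ d ∷ []))) → ∃₂ λ o c →
        SelectOpen (λBP sto (w ++ d ∷ [])) (suc (toℕ i)) o
        × SelectClose (λBP sto (w ++ d ∷ [])) (suc (toℕ i)) c
        × LongestLyndon _≺_ (w ++ d ∷ []) (toℕ i) ((c ∸ o + 1) / 2))
lemma3 {_≺_ = _≺_} sto w d _ d≺w = balanced , opens , closes , select
  where
  open Ranks sto
  T = w ++ d ∷ []
  open NextSmaller (ISA sto T) (length T) (length w) (trans (length-++ w) (+-comm (length w) 1))
                   (sentinel-least w d d≺w)
  balanced : Balanced (λBP sto T)
  balanced = proj₁ wellFormed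
  opens : countOpen (λBP sto T) ≡ length T
  opens = trans (proj₂ wellFormed)
    (trans (length-map (ISA sto T) (upTo (length T))) (length-upTo (length T)))
  closes : countClose (λBP sto T) ≡ length T
  closes = trans (sym (balanced⇒opens≡closes balanced)) opens
  select : (i : Fin (length T)) → ∃₂ λ o c → SelectOpen (λBP sto T) (suc (toℕ i)) o
    × SelectClose (λBP sto T) (suc (toℕ i)) c × LongestLyndon _≺_ T (toℕ i) ((c ∸ o + 1) / 2)
  select i with nextSmaller (toℕ i) (toℕ<n i)
  ... | j , ns@(i<j , j≤T , rj<ri , below) with selected ns
  ...   | o , c , open-o , close-c , half≡ =
    o , c , open-o , close-c ,
    subst (LongestLyndon _≺_ T (toℕ i)) (sym half≡)
      (longestLyndon-nextSmaller T (toℕ i) j i<j j≤T rj<ri below)
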